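{- Let $G$ be a $(k,\rho)$-geodesic-coverable graph and $\ell$ a non-negative integer. Then for every $v\in V(G)$, the ball $B_{\ell\rho}(v)=\{u\in V(G):\mathrm{dist}(u,v)\le \ell\rho\}$ is $(2k(\ell+1),2\rho)$-coverable.
   Context: Graphs are finite, undirected and unweighted, with shortest-path distance $\mathrm{dist}$. A geodesic is a shortest path between its endpoints. $G$ is $(k,\rho)$-geodesic-coverable if there is a family of $k$ geodesics such that every vertex is at distance at most $\rho$ from some vertex of one of them. A set $A\subseteq V(G)$ is $(m,r)$-coverable if there is $D\subseteq V(G)$ with $|D|\le m$ such that every vertex of $A$ is at distance at most $r$ from some vertex of $D$. -}

module Defs where

open import Data.Nat using (ℕ; zero; suc; _≤_)
open import Data.Fin using (Fin)
open import Data.Bool using (Bool; true; false; T)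
open import Data.List using (List; length)
open import Data.List.Membership.Propositional using (_∈_)
open import Data.Product using (Σ; ∃; ∃-syntax; _×_; _,_)
open import Relation.Binary.PropositionalEquality using (_≡_)
open import Relation.Nullary using (¬_)

record Graph : Set where
  field
    n      : ℕ
    edge   : Fin n → Fin n → Bool
    sym    : ∀ u v → edge u v ≡ edge v u
    irrefl : ∀ u → edge u u ≡ false

module _ (G : Graph) where
  open Graph G

  Adj : Fin n → Fin n → Set
  Adj u v = T (edge u v)

  data Walk : Fin n → Fin n → ℕ → Set where
    nil  : ∀ {u} → Walk u u 0
    cons : ∀ {u v w ℓ} → Adj u v → Walk v w ℓ → Walk u w (suc ℓ)

  data _∈W_ (z : Fin n) : ∀ {u w ℓ} → Walk u w ℓ → Set where
    here-nil  : z ∈W (nil {z})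
    here-cons : ∀ {v w ℓ} (a : Adj z v) (p : Walk v w ℓ) → z ∈W cons a p
    there     : ∀ {u v w ℓ} (a : Adj u v) {p : Walk v w ℓ} → z ∈W p → z ∈W cons a p

  -- dist(u,v) ≤ d  (false when u and v lie in different components).
  DistLE : Fin n → Fin n → ℕ → Set
  DistLE u v d = ∃[ ℓ ] (ℓ ≤ d × Walk u v ℓ)

  record Geodesic : Set where
    field
      start end : Fin n
      len       : ℕ
      walk      : Walk start end len
      shortest  : ∀ m → Walk start end m → len ≤ m

  OnGeodesic : Fin n → Geodesic → Set
  OnGeodesic z g = z ∈W Geodesic.walk g

  GeodesicCoverable : ℕ → ℕ → Set
  GeodesicCoverable k ρ =
    Σ (Fin k → Geodesic) λ gs →
      ∀ v → ∃[ i ] ∃[ z ] (OnGeodesic z (gs i) × DistLE v z ρ)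

  Coverable : (Fin n → Set) → ℕ → ℕ → Set
  Coverable A m r =
    Σ (List (Fin n)) λ D → length D ≤ m ×
      (∀ a → A a → ∃[ z ] (z ∈ D × DistLE a z r))

  Ball : Fin n → ℕ → Fin n → Set
  Ball v r u = DistLE u v r

{-# OPTIONS --safe #-}
-- Put R = ℓρ + ρ. A vertex u of B_ℓρ(v) lies within ρ of a vertex z of some covering geodesic γ,
-- and then dist(v, z) ≤ R. If e is the first position on γ within R of v, then z sits at a
-- position j ≥ e, and since γ is a geodesic, j − e ≤ dist(γ(e), z) ≤ 2R. The ℓ + 1 vertices of γ
-- at positions e + (2s + 1)ρ, s ≤ ℓ, are within ρ of every vertex of γ between positions e and
-- e + 2R, hence within 2ρ of u. Only k(ℓ + 1) centres are needed.
module Submission where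

open import Defs
open import Data.Nat using (ℕ; zero; suc; _*_; _+_; _∸_; _≤_; z≤n; s≤s; _≤?_)
open import Data.Nat.Properties hiding (_≟_)
open import Data.Nat.Tactic.RingSolver using (solve-∀)
open import Data.Fin using (Fin; _≟_)
open import Data.Fin.Properties using (any?)
open import Data.Bool using (T)
open import Data.Bool.Properties using (T?)
open import Data.List using (List; []; _∷_; _++_; length; map; cartesianProduct; cartesianProductWith; allFin; upTo)
open import Data.List.Properties using (length-++; length-map; length-tabulate; length-upTo)
open import Data.List.Membership.Propositional using (_∈_)
open import Data.List.Membership.Propositional.Properties using (∈-map⁺; ∈-cartesianProduct⁺; ∈-allFin; ∈-upTo⁺)
open import Data.Product using (∃-syntax; _×_; _,_; uncurry)
open import Data.Sum using (inj₁; inj₂)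
open import Data.Empty using (⊥-elim)
open import Function using (_∘_)
open import Relation.Nullary using (Dec; yes; no)
open import Relation.Nullary.Decidable using (_×-dec_)
open import Relation.Unary using (Decidable)
open import Relation.Binary.PropositionalEquality using (_≡_; refl; sym; cong; cong₂; subst; module ≡-Reasoning)

length-cartesianProductWith : ∀ {A B C : Set} (f : A → B → C) (xs : List A) (ys : List B) →
  length (cartesianProductWith f xs ys) ≡ length xs * length ys
length-cartesianProductWith f [] ys = refl
length-cartesianProductWith f (x ∷ xs) ys = begin
  length (map (f x) ys ++ cartesianProductWith f xs ys)          ≡⟨ length-++ (map (f x) ys) ⟩
  length (map (f x) ys) + length (cartesianProductWith f xs ys)  ≡⟨ cong₂ _+_ (length-map (f x) ys)
                                                                       (length-cartesianProductWith f xs ys) ⟩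
  length ys + length xs * length ys                               ∎
  where open ≡-Reasoning

firstUpTo : {P : ℕ → Set} → Decidable P → ℕ → ℕ
firstUpTo P? zero = zero
firstUpTo {P} P? (suc L) with P? zero
... | yes _ = zero
... | no _ = suc (firstUpTo {P ∘ suc} (P? ∘ suc) L)

firstUpTo-least : ∀ {P : ℕ → Set} (P? : Decidable P) L {j} → P j → j ≤ L →
  firstUpTo P? L ≤ j × P (firstUpTo P? L)
firstUpTo-least P? zero p z≤n = z≤n , p
firstUpTo-least {P} P? (suc L) {j} p j≤L with P? zero | j | j≤L
... | yes p₀ | _ | _ = z≤n , p₀
... | no ¬p₀ | zero | _ = ⊥-elim (¬p₀ p)
... | no ¬p₀ | suc j′ | s≤s j′≤L =
  let first≤j′ , p-first = firstUpTo-least {P ∘ suc} (P? ∘ suc) L p j′≤L in s≤s first≤j′ , p-first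

-- |a − b| ≤ r, stated without truncated subtraction
infix 4 _≈[_]_
_≈[_]_ : ℕ → ℕ → ℕ → Set
a ≈[ r ] b = a ≤ b + r × b ≤ a + r

+-congˡ-≈[] : ∀ c {a b r} → a ≈[ r ] b → c + a ≈[ r ] c + b
+-congˡ-≈[] c {a} {b} {r} (a≤b+r , b≤a+r) =
  subst (c + a ≤_) (sym (+-assoc c b r)) (+-monoʳ-≤ c a≤b+r) ,
  subst (c + b ≤_) (sym (+-assoc c a r)) (+-monoʳ-≤ c b≤a+r)

block-search : ∀ w ℓ {d} → d ≤ suc ℓ * w → ∃[ s ] (s ≤ ℓ × s * w ≤ d × d ≤ suc s * w)
block-search w zero d≤w = zero , z≤n , z≤n , d≤w
block-search w (suc ℓ) {d} d≤bound with d ≤? suc ℓ * w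
... | yes d≤ = let s , s≤ℓ , in-block = block-search w ℓ d≤ in s , m≤n⇒m≤1+n s≤ℓ , in-block
... | no d≰ = suc ℓ , ≤-refl , <⇒≤ (≰⇒> d≰) , d≤bound

block-midpoint-≈[] : ∀ r s {d} → s * (r + r) ≤ d → d ≤ suc s * (r + r) → d ≈[ r ] s * (r + r) + r
block-midpoint-≈[] r s {d} lower upper = subst (d ≤_) (end-of-block r s) upper , +-monoˡ-≤ r lower
  where
  end-of-block : ∀ r s → suc s * (r + r) ≡ s * (r + r) + r + r
  end-of-block = solve-∀

window-≈[] : ∀ r ℓ {e j} → e ≤ j → j ≤ e + suc ℓ * (r + r) →
  ∃[ s ] (s ≤ ℓ × j ≈[ r ] e + (s * (r + r) + r))
window-≈[] r ℓ {e} {j} e≤j j≤e+width =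
  let s , s≤ℓ , lower , upper = block-search (r + r) ℓ (m≤n+o⇒m∸n≤o j e j≤e+width)
  in s , s≤ℓ , subst (_≈[ r ] e + (s * (r + r) + r)) (m+[n∸m]≡n e≤j)
                   (+-congˡ-≈[] e (block-midpoint-≈[] r s lower upper))

module WalkProperties (G : Graph) where
  open Graph G renaming (sym to edge-sym)

  private
    variable
      u v w x : Fin n
      a b d e : ℕ

  Adj-sym : Adj G u v → Adj G v u
  Adj-sym {u} {v} = subst T (edge-sym u v)

  _++ʷ_ : Walk G u v a → Walk G v w b → Walk G u w (a + b)
  nil      ++ʷ q = q
  cons e p ++ʷ q = cons e (p ++ʷ q)

  _∷ʳʷ_ : Walk G u v a → Adj G v w → Walk G u w (suc a)
  nil      ∷ʳʷ e′ = cons e′ nil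
  cons e p ∷ʳʷ e′ = cons e (p ∷ʳʷ e′)

  reverseʷ : Walk G u v a → Walk G v u a
  reverseʷ nil        = nil
  reverseʷ (cons e p) = reverseʷ p ∷ʳʷ Adj-sym e

  DistLE-sym : DistLE G u v d → DistLE G v u d
  DistLE-sym (a , a≤d , p) = a , a≤d , reverseʷ p

  DistLE-trans : DistLE G u v d → DistLE G v w e → DistLE G u w (d + e)
  DistLE-trans (a , a≤d , p) (b , b≤e , q) = a + b , +-mono-≤ a≤d b≤e , p ++ʷ q

  DistLE-mono : d ≤ e → DistLE G u v d → DistLE G u v e
  DistLE-mono d≤e (a , a≤d , p) = a , ≤-trans a≤d d≤e , p

  DistLE-cons : Adj G u v → DistLE G v w d → DistLE G u w (suc d)
  DistLE-cons e (a , a≤d , p) = suc a , s≤s a≤d , cons e p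

  DistLE? : ∀ d u w → Dec (DistLE G u w d)
  DistLE? d u w with u ≟ w
  ... | yes refl = yes (0 , z≤n , nil)
  DistLE? zero u w | no u≢w = no λ { (zero , _ , nil) → u≢w refl }
  DistLE? (suc d) u w | no u≢w with any? (λ x → T? (edge u x) ×-dec DistLE? d x w)
  ... | yes (x , e , near) = yes (DistLE-cons e near)
  ... | no ¬step = no λ { (zero , _ , nil) → u≢w refl
                        ; (suc a , s≤s a≤d , cons e p) → ¬step (_ , e , a , a≤d , p) }

  -- Positions past the end of the walk all denote its last vertex.
  vertexAt : Walk G u w a → ℕ → Fin n
  vertexAt {u} nil        _       = u
  vertexAt {u} (cons _ _) zero    = u
  vertexAt     (cons _ p) (suc j) = vertexAt p j

  vertexAt-zero : (p : Walk G u w a) → vertexAt p 0 ≡ u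
  vertexAt-zero nil        = refl
  vertexAt-zero (cons _ _) = refl

  ∈W⇒vertexAt : {p : Walk G u w a} → _∈W_ G x p → ∃[ j ] (j ≤ a × vertexAt p j ≡ x)
  ∈W⇒vertexAt here-nil        = 0 , z≤n , refl
  ∈W⇒vertexAt (here-cons _ _) = 0 , z≤n , refl
  ∈W⇒vertexAt (there _ x∈p)   = let j , j≤a , at-j = ∈W⇒vertexAt x∈p in suc j , s≤s j≤a , at-j

  takeʷ : (p : Walk G u w a) (j : ℕ) → j ≤ a → Walk G u (vertexAt p j) j
  takeʷ nil        zero    _         = nil
  takeʷ (cons _ _) zero    _         = nil
  takeʷ (cons e p) (suc j) (s≤s j≤a) = cons e (takeʷ p j j≤a)

  dropʷ : (p : Walk G u w a) (j : ℕ) → j ≤ a → Walk G (vertexAt p j) w (a ∸ j)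
  dropʷ nil        zero    _         = nil
  dropʷ (cons e p) zero    _         = cons e p
  dropʷ (cons e p) (suc j) (s≤s j≤a) = dropʷ p j j≤a

  vertexAt-DistLE : (p : Walk G u w a) (i j : ℕ) → i ≤ j → DistLE G (vertexAt p i) (vertexAt p j) (j ∸ i)
  vertexAt-DistLE nil        _       _       _         = 0 , z≤n , nil
  vertexAt-DistLE (cons _ _) zero    zero    _         = 0 , z≤n , nil
  vertexAt-DistLE (cons e p) zero    (suc j) _         =
    DistLE-cons e (subst (λ y → DistLE G y (vertexAt p j) j) (vertexAt-zero p) (vertexAt-DistLE p 0 j z≤n))
  vertexAt-DistLE (cons _ p) (suc i) (suc j) (s≤s i≤j) = vertexAt-DistLE p i j i≤j

  vertexAt-≈[] : (p : Walk G u w a) {i j r : ℕ} → i ≈[ r ] j → DistLE G (vertexAt p i) (vertexAt p j) r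
  vertexAt-≈[] p {i} {j} (i≤j+r , j≤i+r) with ≤-total i j
  ... | inj₁ i≤j = DistLE-mono (m≤n+o⇒m∸n≤o j i j≤i+r) (vertexAt-DistLE p i j i≤j)
  ... | inj₂ j≤i = DistLE-sym (DistLE-mono (m≤n+o⇒m∸n≤o i j i≤j+r) (vertexAt-DistLE p j i j≤i))

module GeodesicProperties {G : Graph} (γ : Geodesic G) where
  open Geodesic γ
  open WalkProperties G

  geodesic-position-≤ : ∀ {i j d} → i ≤ len → j ≤ len →
    DistLE G (vertexAt walk i) (vertexAt walk j) d → j ≤ i + d
  geodesic-position-≤ {i} {j} {d} i≤len j≤len (a , a≤d , p) = ≤-trans j≤i+a (+-monoʳ-≤ i a≤d)
    where
    open ≤-Reasoning
    j≤i+a : j ≤ i + a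
    j≤i+a = +-cancelʳ-≤ (len ∸ j) j (i + a) (begin
      j + (len ∸ j)        ≡⟨ m+[n∸m]≡n j≤len ⟩
      len                  ≤⟨ shortest _ (takeʷ walk i i≤len ++ʷ (p ++ʷ dropʷ walk j j≤len)) ⟩
      i + (a + (len ∸ j))  ≡⟨ +-assoc i a (len ∸ j) ⟨
      i + a + (len ∸ j)    ∎)

module BallCover {G : Graph} {k : ℕ} (γs : Fin k → Geodesic G) (v : Fin (Graph.n G)) (ρ ℓ : ℕ) where
  open Graph G using (n)
  open WalkProperties G

  R : ℕ
  R = ℓ * ρ + ρ

  len : Fin k → ℕ
  len i = Geodesic.len (γs i)

  vertex : Fin k → ℕ → Fin n
  vertex i = vertexAt (Geodesic.walk (γs i))

  entry : Fin k → ℕ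
  entry i = firstUpTo (λ j → DistLE? R v (vertex i j)) (len i)

  centre : Fin k → ℕ → Fin n
  centre i s = vertex i (entry i + (s * (ρ + ρ) + ρ))

  centres : List (Fin n)
  centres = map (uncurry centre) (cartesianProduct (allFin k) (upTo (suc ℓ)))

  length-centres : length centres ≡ k * suc ℓ
  length-centres = begin
    length centres                                ≡⟨ length-map (uncurry centre) pairs ⟩
    length pairs                                  ≡⟨ length-cartesianProductWith _,_ (allFin k) (upTo (suc ℓ)) ⟩
    length (allFin k) * length (upTo (suc ℓ))     ≡⟨ cong₂ _*_ (length-tabulate {A = Fin k} (λ i → i))
                                                                (length-upTo (suc ℓ)) ⟩
    k * suc ℓ                                     ∎
    where
    open ≡-Reasoning
    pairs = cartesianProduct (allFin k) (upTo (suc ℓ))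

  centre-∈ : ∀ i {s} → s ≤ ℓ → centre i s ∈ centres
  centre-∈ i s≤ℓ = ∈-map⁺ (uncurry centre) (∈-cartesianProduct⁺ (∈-allFin i) (∈-upTo⁺ (s≤s s≤ℓ)))

  entry-window : ∀ i j → j ≤ len i → DistLE G v (vertex i j) R →
    entry i ≤ j × j ≤ entry i + (R + R)
  entry-window i j j≤len v~j =
    let entry≤j , v~entry = firstUpTo-least (λ j → DistLE? R v (vertex i j)) (len i) v~j j≤len
    in entry≤j , geodesic-position-≤ (≤-trans entry≤j j≤len) j≤len
                   (DistLE-trans (DistLE-sym v~entry) v~j)
    where open GeodesicProperties (γs i)

  near-centre : ∀ i j → j ≤ len i → DistLE G v (vertex i j) R →
    ∃[ s ] (s ≤ ℓ × DistLE G (vertex i j) (centre i s) ρ)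
  near-centre i j j≤len v~j =
    let entry≤j , j≤entry+2R = entry-window i j j≤len v~j
        s , s≤ℓ , j≈centre = window-≈[] ρ ℓ entry≤j
                               (subst (λ b → j ≤ entry i + b) (double-radius ℓ ρ) j≤entry+2R)
    in s , s≤ℓ , vertexAt-≈[] (Geodesic.walk (γs i)) j≈centre
    where
    double-radius : ∀ ℓ ρ → (ℓ * ρ + ρ) + (ℓ * ρ + ρ) ≡ suc ℓ * (ρ + ρ)
    double-radius = solve-∀

  ball-covered : (∀ u → ∃[ i ] ∃[ z ] (OnGeodesic G z (γs i) × DistLE G u z ρ)) →
    ∀ u → Ball G v (ℓ * ρ) u → ∃[ x ] (x ∈ centres × DistLE G u x (2 * ρ))
  ball-covered covering u u∈B with covering u
  ... | i , z , z∈γ , u~z with ∈W⇒vertexAt z∈γ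
  ... | j , j≤len , refl =
    let s , s≤ℓ , z~centre = near-centre i j j≤len (DistLE-trans (DistLE-sym u∈B) u~z)
    in centre i s , centre-∈ i s≤ℓ , DistLE-mono ρ+ρ≤2*ρ (DistLE-trans u~z z~centre)
    where
    ρ+ρ≤2*ρ : ρ + ρ ≤ 2 * ρ
    ρ+ρ≤2*ρ = ≤-reflexive (cong (ρ +_) (sym (+-identityʳ ρ)))

lemma4p1 : (G : Graph) (k ρ ℓ : ℕ) → GeodesicCoverable G k ρ →
    (v : Fin (Graph.n G)) → Coverable G (Ball G v (ℓ * ρ)) (2 * k * (ℓ + 1)) (2 * ρ)
lemma4p1 G k ρ ℓ (γs , covering) v = centres , length-bound , ball-covered covering
  where
  open BallCover γs v ρ ℓ
  length-bound : length centres ≤ 2 * k * (ℓ + 1)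
  length-bound = begin
    length centres         ≡⟨ length-centres ⟩
    k * suc ℓ              ≤⟨ m≤m+n (k * suc ℓ) (k * suc ℓ) ⟩
    k * suc ℓ + k * suc ℓ  ≡⟨ double k ℓ ⟩
    2 * k * (ℓ + 1)        ∎
    where
    open ≤-Reasoning
    double : ∀ k ℓ → k * suc ℓ + k * suc ℓ ≡ 2 * k * (ℓ + 1)
    double = solve-∀
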